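{- Let $G$ be a connected graph, let $\{u,v\}$ be a diameter pair of $G$, let $s\geq 2$ be an integer, and let $d={\rm diam}(G)>s$. If a graph $H$ of diameter at most $s$ can be obtained from $G$ by contracting a set $S$ of at most $k=d-s$ edges (i.e., $H=G/S$), then $|S|=k$ and there is a $(u,v)$-path $P$ of length $d$ in $G$ such that $S\subseteq E(P)$.
   Context: All graphs are finite, simple and undirected. ${\rm diam}(G)$ is the maximum distance between two vertices of $G$; $\{u,v\}$ is a diameter pair if ${\rm dist}_G(u,v)={\rm diam}(G)$. For $S\subseteq E(G)$, $G/S$ is the graph obtained by contracting all edges of $S$, where contracting $uv$ replaces $u,v$ by a new vertex adjacent to exactly the vertices that were adjacent to $u$ or $v$. The length of a path is its number of edges. -}

module Defs where

open import Data.Nat using (ℕ; zero; suc; _≤_)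
open import Data.Fin using (Fin; zero; suc; inject₁; fromℕ; _<_)
open import Data.Product using (Σ; ∃; ∃-syntax; _×_; _,_)
open import Data.Sum using (_⊎_)
open import Data.List using (List)
open import Data.List.Membership.Propositional using (_∈_)
open import Data.Empty using (⊥)
open import Relation.Nullary using (¬_)
open import Relation.Binary.PropositionalEquality using (_≡_)
open import Function.Definitions using (Injective)

record Graph : Set₁ where
  field
    n       : ℕ
    Adj     : Fin n → Fin n → Set
    sym     : ∀ {x y} → Adj x y → Adj y x
    irrefl  : ∀ {x} → ¬ Adj x x

module _ (G : Graph) where
  open Graph G

  data Walk : ℕ → Fin n → Fin n → Set where
    nil  : ∀ {x} → Walk zero x x
    cons : ∀ {l x y z} → Adj x y → Walk l y z → Walk (suc l) x z

  Connected : Set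
  Connected = ∀ x y → ∃[ l ] Walk l x y

  DistLe : ℕ → Fin n → Fin n → Set
  DistLe m x y = ∃[ l ] (l ≤ m × Walk l x y)

  Dist : Fin n → Fin n → ℕ → Set
  Dist x y d = DistLe d x y × (∀ l → Walk l x y → d ≤ l)

  Diam : ℕ → Set
  Diam d = (∀ x y → DistLe d x y) × ∃[ x ] ∃[ y ] Dist x y d

  -- An edge {a,b} is represented canonically as the pair (a , b) with a < b.
  Edge : Set
  Edge = Fin n × Fin n

  IsEdge : Edge → Set
  IsEdge (a , b) = a < b × Adj a b

  InS : List Edge → Fin n → Fin n → Set
  InS S a b = (a , b) ∈ S ⊎ (b , a) ∈ S

  -- x and y are merged into the same vertex of G/S:
  -- they lie in the same component of the spanning subgraph (V(G), S).
  data Merged (S : List Edge) : Fin n → Fin n → Set where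
    here : ∀ {x} → Merged S x x
    step : ∀ {x y z} → InS S x y → Merged S y z → Merged S x z

  -- adjacency in G/S between the vertices represented by x and y:
  -- distinct contracted vertices, with some G-edge between the two classes.
  ContrAdj : List Edge → Fin n → Fin n → Set
  ContrAdj S x y = ¬ Merged S x y × ∃[ a ] ∃[ b ] (Merged S x a × Merged S y b × Adj a b)

  data ContrDistLe (S : List Edge) : ℕ → Fin n → Fin n → Set where
    here : ∀ {m x y} → Merged S x y → ContrDistLe S m x y
    step : ∀ {m x y z} → ContrAdj S x z → ContrDistLe S m z y → ContrDistLe S (suc m) x y

  -- diam(G/S) ≤ s  (every vertex of G/S is the class of some vertex of G)
  ContrDiamLe : List Edge → ℕ → Set
  ContrDiamLe S s = ∀ x y → ContrDistLe S s x y

  record Path (u v : Fin n) (d : ℕ) : Set where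
    field
      vtx     : Fin (suc d) → Fin n
      start   : vtx zero ≡ u
      end     : vtx (fromℕ d) ≡ v
      adj     : ∀ (i : Fin d) → Adj (vtx (inject₁ i)) (vtx (suc i))
      distinct : Injective _≡_ _≡_ vtx

  EdgeOf : ∀ {u v d} → Path u v d → Edge → Set
  EdgeOf {d = d} P (a , b) =
    ∃[ i ] ((vtx (inject₁ i) ≡ a × vtx (suc i) ≡ b) ⊎ (vtx (inject₁ i) ≡ b × vtx (suc i) ≡ a))
    where open Path P

-- Lift a shortest (u,v)-path of G/S to a (u,v)-walk of G consisting of S-edges and at most s
-- other edges, and shortcut it to a path; shortcutting adds no non-S edges.  A path uses each
-- edge of S at most once, so its length is at most |S| + s ≤ d, while dist(u,v) = d bounds it
-- from below.  All these inequalities are therefore equalities: the path has length d and its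
-- d - s distinct S-edges exhaust S.

module Submission where

open import Defs
open import Data.Nat using (ℕ; suc; _+_; _∸_; _≤_; _<_; z≤n; s≤s)
open import Data.Nat.Properties
open import Data.Fin using (Fin; zero; suc; inject₁; fromℕ) renaming (_≟_ to _≟ᶠ_)
open import Data.Fin.Properties using (any?)
open import Data.Product using (Σ; ∃; _×_; _,_; proj₁; proj₂)
open import Data.Product.Properties using (≡-dec)
open import Data.Sum using (_⊎_; inj₁; inj₂)
open import Data.Unit using (⊤; tt)
open import Data.List using (List; []; _∷_; length)
open import Data.List.Properties using (length-removeAt′)
open import Data.List.Membership.Propositional using (_∈_)
open import Data.List.Relation.Binary.Subset.Propositional using (_⊆_)
open import Data.List.Relation.Unary.Any using (here; there; index; _─_)
import Data.List.Relation.Unary.Any as Any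
open import Data.List.Relation.Unary.All using (All)
import Data.List.Relation.Unary.All as All
open import Data.List.Relation.Unary.AllPairs using ([]; _∷_)
open import Data.List.Relation.Unary.Unique.Propositional using (Unique)
open import Relation.Binary.Definitions using (DecidableEquality)
open import Relation.Binary.PropositionalEquality using (_≡_; _≢_; refl; sym; trans; cong; subst)
open import Relation.Nullary using (¬_; yes; no; contradiction)

module _ {a} {A : Set a} where

  ∈-─ : ∀ {x y : A} {xs} (x∈xs : x ∈ xs) → y ∈ xs → y ≢ x → y ∈ (xs ─ x∈xs)
  ∈-─ (here refl) (here refl) y≢x = contradiction refl y≢x
  ∈-─ (here refl) (there y∈xs) _  = y∈xs
  ∈-─ (there _)   (here y≡)    _  = here y≡
  ∈-─ (there x∈xs) (there y∈xs) y≢x = there (∈-─ x∈xs y∈xs y≢x)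

  unique-⊆⇒length-≤ : ∀ {xs ys : List A} → Unique xs → xs ⊆ ys → length xs ≤ length ys
  unique-⊆⇒length-≤ {[]}     _              _     = z≤n
  unique-⊆⇒length-≤ {x ∷ xs} {ys} (x∉xs ∷ uxs) xs⊆ys =
    subst (suc (length xs) ≤_) (sym (length-removeAt′ ys (index x∈ys)))
      (s≤s (unique-⊆⇒length-≤ uxs xs⊆ys─x))
    where
    x∈ys = xs⊆ys (here refl)
    xs⊆ys─x : xs ⊆ (ys ─ x∈ys)
    xs⊆ys─x y∈xs = ∈-─ x∈ys (xs⊆ys (there y∈xs)) λ y≡x → All.lookup x∉xs y∈xs (sym y≡x)

  unique-⊆-length-≥⇒⊇ : DecidableEquality A → ∀ {xs ys : List A} →
    Unique xs → xs ⊆ ys → length ys ≤ length xs → ys ⊆ xs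
  unique-⊆-length-≥⇒⊇ _≟_ {xs} {ys} uxs xs⊆ys ys≤xs {y} y∈ys with Any.any? (y ≟_) xs
  ... | yes y∈xs = y∈xs
  ... | no  y∉xs = contradiction (≤-trans (unique-⊆⇒length-≤ uy∷xs y∷xs⊆ys) ys≤xs) (n≮n (length xs))
    where
    uy∷xs : Unique (y ∷ xs)
    uy∷xs = All.tabulate (λ z∈xs y≡z → y∉xs (subst (_∈ xs) (sym y≡z) z∈xs)) ∷ uxs
    y∷xs⊆ys : y ∷ xs ⊆ ys
    y∷xs⊆ys (here refl)  = y∈ys
    y∷xs⊆ys (there z∈xs) = xs⊆ys z∈xs

module _ (G : Graph) where
  open Graph G renaming (sym to Adj-sym)

  module _ {S : List (Edge G)} where

    InS-sym : ∀ {x y} → InS G S x y → InS G S y x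
    InS-sym (inj₁ p) = inj₂ p
    InS-sym (inj₂ p) = inj₁ p

    Merged-trans : ∀ {x y z} → Merged G S x y → Merged G S y z → Merged G S x z
    Merged-trans here         m = m
    Merged-trans (step xy my) m = step xy (Merged-trans my m)

    Merged-sym : ∀ {x y} → Merged G S x y → Merged G S y x
    Merged-sym here         = here
    Merged-sym (step xy my) = Merged-trans (Merged-sym my) (step (InS-sym xy) here)

  -- Each step of a marked walk is an edge of S to be contracted or a kept edge, so the
  -- walk's image in G/S has length at most the number of kept steps.
  module MarkedWalks (S : List (Edge G)) where

    data Step (x y : Fin n) : Set where
      contract : Adj x y → InS G S x y → Step x y
      keep     : Adj x y → Step x y

    stepAdj : ∀ {x y} → Step x y → Adj x y
    stepAdj (contract xy _) = xy
    stepAdj (keep xy)       = xy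

    data MWalk : Fin n → Fin n → Set where
      []  : ∀ {x} → MWalk x x
      _∷_ : ∀ {x y z} → Step x y → MWalk y z → MWalk x z

    steps : ∀ {x z} → MWalk x z → ℕ
    steps []      = 0
    steps (_ ∷ w) = suc (steps w)

    kept : ∀ {x z} → MWalk x z → ℕ
    kept []                 = 0
    kept (contract _ _ ∷ w) = kept w
    kept (keep _ ∷ w)       = suc (kept w)

    _++_ : ∀ {x y z} → MWalk x y → MWalk y z → MWalk x z
    []      ++ w = w
    (t ∷ v) ++ w = t ∷ (v ++ w)

    kept-++ : ∀ {x y z} (v : MWalk x y) (w : MWalk y z) → kept (v ++ w) ≡ kept v + kept w
    kept-++ []                 w = refl
    kept-++ (contract _ _ ∷ v) w = kept-++ v w
    kept-++ (keep _ ∷ v)       w = cong suc (kept-++ v w)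

    edgeOfS : ∀ {a b} → InS G S a b → Edge G
    edgeOfS {a} {b} (inj₁ _) = a , b
    edgeOfS {a} {b} (inj₂ _) = b , a

    edgeOfS∈S : ∀ {a b} (ab : InS G S a b) → edgeOfS ab ∈ S
    edgeOfS∈S (inj₁ p) = p
    edgeOfS∈S (inj₂ p) = p

    contracted : ∀ {x z} → MWalk x z → List (Edge G)
    contracted []                  = []
    contracted (contract _ ab ∷ w) = edgeOfS ab ∷ contracted w
    contracted (keep _ ∷ w)        = contracted w

    contracted⊆S : ∀ {x z} (w : MWalk x z) → contracted w ⊆ S
    contracted⊆S (contract _ ab ∷ w) (here refl) = edgeOfS∈S ab
    contracted⊆S (contract _ ab ∷ w) (there e∈)  = contracted⊆S w e∈
    contracted⊆S (keep _ ∷ w)        e∈          = contracted⊆S w e∈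

    steps≡contracted+kept : ∀ {x z} (w : MWalk x z) → steps w ≡ length (contracted w) + kept w
    steps≡contracted+kept []                 = refl
    steps≡contracted+kept (contract _ _ ∷ w) = cong suc (steps≡contracted+kept w)
    steps≡contracted+kept (keep _ ∷ w)       =
      trans (cong suc (steps≡contracted+kept w)) (sym (+-suc _ _))

    toWalk : ∀ {x z} (w : MWalk x z) → Walk G (steps w) x z
    toWalk []      = nil
    toWalk (t ∷ w) = cons (stepAdj t) (toWalk w)

    vertex : ∀ {x z} (w : MWalk x z) → Fin (suc (steps w)) → Fin n
    vertex {x} []      zero    = x
    vertex {x} (_ ∷ w) zero    = x
    vertex     (_ ∷ w) (suc i) = vertex w i

    vertex-zero : ∀ {x z} (w : MWalk x z) → vertex w zero ≡ x
    vertex-zero []      = refl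
    vertex-zero (_ ∷ w) = refl

    vertex-last : ∀ {x z} (w : MWalk x z) → vertex w (fromℕ (steps w)) ≡ z
    vertex-last []      = refl
    vertex-last (_ ∷ w) = vertex-last w

    vertex-adj : ∀ {x z} (w : MWalk x z) (i : Fin (steps w)) →
      Adj (vertex w (inject₁ i)) (vertex w (suc i))
    vertex-adj (t ∷ w) zero    = subst (Adj _) (sym (vertex-zero w)) (stepAdj t)
    vertex-adj (t ∷ w) (suc i) = vertex-adj w i

    OnWalk : ∀ {x z} → MWalk x z → Fin n → Set
    OnWalk w a = ∃ λ i → vertex w i ≡ a

    Simple : ∀ {x z} → MWalk x z → Set
    Simple         []      = ⊤
    Simple {x = x} (_ ∷ w) = ¬ OnWalk w x × Simple w

    vertex-injective : ∀ {x z} (w : MWalk x z) → Simple w → ∀ {i j} → vertex w i ≡ vertex w j → i ≡ j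
    vertex-injective []      _            {zero}  {zero}  _  = refl
    vertex-injective (_ ∷ w) _            {zero}  {zero}  _  = refl
    vertex-injective (_ ∷ w) (x∉w , _)    {zero}  {suc j} eq = contradiction (j , sym eq) x∉w
    vertex-injective (_ ∷ w) (x∉w , _)    {suc i} {zero}  eq = contradiction (i , eq) x∉w
    vertex-injective (_ ∷ w) (_ , simple) {suc i} {suc j} eq = cong suc (vertex-injective w simple eq)

    toPath : ∀ {x z} (w : MWalk x z) → Simple w → Path G x z (steps w)
    toPath w simple = record
      { vtx = vertex w ; start = vertex-zero w ; end = vertex-last w
      ; adj = vertex-adj w ; distinct = vertex-injective w simple }

    Traverses : ∀ {x z} → MWalk x z → Edge G → Set
    Traverses w (a , b) = ∃ λ i →
      (vertex w (inject₁ i) ≡ a × vertex w (suc i) ≡ b) ⊎ (vertex w (inject₁ i) ≡ b × vertex w (suc i) ≡ a)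

    traverses-∷ : ∀ {x y z} {t : Step x y} {w : MWalk y z} e → Traverses w e → Traverses (t ∷ w) e
    traverses-∷ (_ , _) (i , on) = suc i , on

    traverses-contracted : ∀ {x z} (w : MWalk x z) {e} → e ∈ contracted w → Traverses w e
    traverses-contracted (contract _ (inj₁ _) ∷ w) (here refl) = zero , inj₁ (refl , vertex-zero w)
    traverses-contracted (contract _ (inj₂ _) ∷ w) (here refl) = zero , inj₂ (refl , vertex-zero w)
    traverses-contracted (contract _ _ ∷ w) {e} (there e∈) = traverses-∷ e (traverses-contracted w e∈)
    traverses-contracted (keep _ ∷ w)       {e} e∈         = traverses-∷ e (traverses-contracted w e∈)

    traverses⇒EdgeOf : ∀ {x z} {w : MWalk x z} (simple : Simple w) e →
      Traverses w e → EdgeOf G (toPath w simple) e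
    traverses⇒EdgeOf _ (_ , _) tr = tr

    traverses⇒onWalk : ∀ {x z} {w : MWalk x z} {a b} → Traverses w (a , b) → OnWalk w a × OnWalk w b
    traverses⇒onWalk (i , inj₁ (a≡ , b≡)) = (inject₁ i , a≡) , (suc i , b≡)
    traverses⇒onWalk (i , inj₂ (b≡ , a≡)) = (suc i , a≡) , (inject₁ i , b≡)

    contracted-unique : ∀ {x z} (w : MWalk x z) → Simple w → Unique (contracted w)
    contracted-unique []                  _              = []
    contracted-unique (keep _ ∷ w)        (_ , simple)   = contracted-unique w simple
    contracted-unique (contract _ xy ∷ w) (x∉w , simple) =
      All.tabulate (fresh xy) ∷ contracted-unique w simple
      where
      fresh : ∀ {e} xy → e ∈ contracted w → edgeOfS xy ≢ e
      fresh (inj₁ _) e∈ refl = x∉w (proj₁ (traverses⇒onWalk (traverses-contracted w e∈)))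
      fresh (inj₂ _) e∈ refl = x∉w (proj₂ (traverses⇒onWalk (traverses-contracted w e∈)))

    suffix : ∀ {x z} (w : MWalk x z) (i : Fin (suc (steps w))) → MWalk (vertex w i) z
    suffix []      zero    = []
    suffix (t ∷ w) zero    = t ∷ w
    suffix (t ∷ w) (suc i) = suffix w i

    suffix-simple : ∀ {x z} (w : MWalk x z) i → Simple w → Simple (suffix w i)
    suffix-simple []      zero    simple       = simple
    suffix-simple (t ∷ w) zero    simple       = simple
    suffix-simple (t ∷ w) (suc i) (_ , simple) = suffix-simple w i simple

    kept-suffix : ∀ {x z} (w : MWalk x z) i → kept (suffix w i) ≤ kept w
    kept-suffix []                 zero    = ≤-refl
    kept-suffix (_ ∷ w)            zero    = ≤-refl
    kept-suffix (contract _ _ ∷ w) (suc i) = kept-suffix w i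
    kept-suffix (keep _ ∷ w)       (suc i) = m≤n⇒m≤1+n (kept-suffix w i)

    kept-∷ : ∀ {x y z} (t : Step x y) (w : MWalk y z) → kept w ≤ kept (t ∷ w)
    kept-∷ (contract _ _) w = ≤-refl
    kept-∷ (keep _)       w = n≤1+n (kept w)

    ∷-mono-kept : ∀ {x y z} (t : Step x y) {v w : MWalk y z} → kept v ≤ kept w → kept (t ∷ v) ≤ kept (t ∷ w)
    ∷-mono-kept (contract _ _) v≤w = v≤w
    ∷-mono-kept (keep _)       v≤w = s≤s v≤w

    shortcut : ∀ {x z} (w : MWalk x z) → Σ (MWalk x z) λ w′ → Simple w′ × kept w′ ≤ kept w
    shortcut [] = [] , tt , ≤-refl
    shortcut {x} (t ∷ w) with shortcut w
    ... | w′ , simple , w′≤w with any? (λ i → vertex w′ i ≟ᶠ x)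
    ...   | yes (i , refl) = suffix w′ i , suffix-simple w′ i simple ,
                             ≤-trans (kept-suffix w′ i) (≤-trans w′≤w (kept-∷ t w))
    ...   | no x∉w′        = t ∷ w′ , (x∉w′ , simple) , ∷-mono-kept t w′≤w

    module _ (S-edges : All (IsEdge G) S) where

      InS⇒Adj : ∀ {a b} → InS G S a b → Adj a b
      InS⇒Adj (inj₁ p) = proj₂ (All.lookup S-edges p)
      InS⇒Adj (inj₂ p) = Adj-sym (proj₂ (All.lookup S-edges p))

      merged⇒walk : ∀ {x y} → Merged G S x y → Σ (MWalk x y) λ w → kept w ≡ 0
      merged⇒walk here = [] , refl
      merged⇒walk (step xy m) with merged⇒walk m
      ... | w , kept≡0 = contract (InS⇒Adj xy) xy ∷ w , kept≡0

      contrDistLe⇒walk : ∀ {m x y} → ContrDistLe G S m x y → Σ (MWalk x y) λ w → kept w ≤ m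
      contrDistLe⇒walk (here x~y) with merged⇒walk x~y
      ... | w , kept≡0 = w , subst (_≤ _) (sym kept≡0) z≤n
      contrDistLe⇒walk {suc m} (step (_ , a , b , x~a , z~b , ab) rest)
        with merged⇒walk x~a | merged⇒walk (Merged-sym z~b) | contrDistLe⇒walk rest
      ... | w₁ , k₁ | w₂ , k₂ | w₃ , k₃ = w₁ ++ (keep ab ∷ (w₂ ++ w₃)) , bound
        where
        bound : kept (w₁ ++ (keep ab ∷ (w₂ ++ w₃))) ≤ suc m
        bound = begin
          kept (w₁ ++ (keep ab ∷ (w₂ ++ w₃)))  ≡⟨ kept-++ w₁ _ ⟩
          kept w₁ + suc (kept (w₂ ++ w₃))      ≡⟨ cong (λ k → k + suc (kept (w₂ ++ w₃))) k₁ ⟩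
          suc (kept (w₂ ++ w₃))                ≡⟨ cong suc (kept-++ w₂ w₃) ⟩
          suc (kept w₂ + kept w₃)              ≡⟨ cong (λ k → suc (k + kept w₃)) k₂ ⟩
          suc (kept w₃)                        ≤⟨ s≤s k₃ ⟩
          suc m                                ∎
          where open ≤-Reasoning

      contrDistLe⇒simpleWalk : ∀ {m x y} → ContrDistLe G S m x y → Σ (MWalk x y) λ p → Simple p × kept p ≤ m
      contrDistLe⇒simpleWalk xy with contrDistLe⇒walk xy
      ... | w , kept-w≤m with shortcut w
      ...   | p , simple , kept-p≤w = p , simple , ≤-trans kept-p≤w kept-w≤m

squeeze : ∀ {a b c d s} → s ≤ d → a ≤ b → b ≤ d ∸ s → c ≤ s → d ≤ a + c →
  a ≡ b × b ≡ d ∸ s × a + c ≡ d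
squeeze {a} {b} {c} {d} {s} s≤d a≤b b≤d∸s c≤s d≤a+c = trans a≡d∸s (sym b≡d∸s) , b≡d∸s , a+c≡d
  where
  d∸s≤a : d ∸ s ≤ a
  d∸s≤a = m≤n+o⇒m∸n≤o d s (≤-trans d≤a+c (subst (a + c ≤_) (+-comm a s) (+-monoʳ-≤ a c≤s)))
  a≡d∸s = ≤-antisym (≤-trans a≤b b≤d∸s) d∸s≤a
  b≡d∸s = ≤-antisym b≤d∸s (≤-trans d∸s≤a a≤b)
  a+c≡d = ≤-antisym (subst (a + c ≤_) (m∸n+n≡m s≤d) (+-mono-≤ (≤-trans a≤b b≤d∸s) c≤s)) d≤a+c

-- Only the lower bound dist(u,v) ≥ d is used.
lemma9 : (G : Graph) → Connected G →
    (u v : Fin (Graph.n G)) (s d : ℕ) →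
    Diam G d → Dist G u v d → 2 ≤ s → s < d →
    (S : List (Edge G)) → All (IsEdge G) S → Unique S →
    length S ≤ d ∸ s → ContrDiamLe G S s →
    (length S ≡ d ∸ s) × (Σ (Path G u v d) λ P → All (EdgeOf G P) S)
lemma9 G _ u v s d _ (_ , d≤dist) _ s<d S S-edges _ |S|≤d∸s diam≤s
  with MarkedWalks.contrDistLe⇒simpleWalk G S S-edges (diam≤s u v)
... | p , simple , kept≤s =
  |S|≡d∸s , subst (λ l → Σ (Path G u v l) λ P → All (EdgeOf G P) S) steps≡d (toPath p simple , S-onPath)
  where
  open MarkedWalks G S
  L-unique : Unique (contracted p)
  L-unique = contracted-unique p simple
  counts : length (contracted p) ≡ length S × length S ≡ d ∸ s × length (contracted p) + kept p ≡ d
  counts = squeeze (<⇒≤ s<d) (unique-⊆⇒length-≤ L-unique (contracted⊆S p)) |S|≤d∸s kept≤s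
                   (subst (d ≤_) (steps≡contracted+kept p) (d≤dist _ (toWalk p)))
  |S|≡d∸s : length S ≡ d ∸ s
  |S|≡d∸s = proj₁ (proj₂ counts)
  steps≡d : steps p ≡ d
  steps≡d = trans (steps≡contracted+kept p) (proj₂ (proj₂ counts))
  S⊆L : S ⊆ contracted p
  S⊆L = unique-⊆-length-≥⇒⊇ (≡-dec _≟ᶠ_ _≟ᶠ_) L-unique (contracted⊆S p) (≤-reflexive (sym (proj₁ counts)))
  S-onPath : All (EdgeOf G (toPath p simple)) S
  S-onPath = All.tabulate λ {e} e∈S → traverses⇒EdgeOf simple e (traverses-contracted p (S⊆L e∈S))
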